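{- Let $f$ be a partial $2$-tone edge $10$-coloring of a subcubic graph $G$. If $G$ contains a vertex $u$ of degree two whose two incident edges are both uncolored, then $f$ can be extended to these two edges.
   Context: All graphs are simple and finite; subcubic means maximum degree at most $3$. The distance $d_G(e,e')$ between edges is the distance between the corresponding vertices in the line graph $L(G)$. A partial $2$-tone edge $k$-coloring of $G$ is a map $f:E'\to\binom{\{1,\dots,k\}}{2}$ for some $E'\subseteq E(G)$ such that for all distinct $e,e'\in E'$, $|f(e)\cap f(e')|<d_G(e,e')$; edges outside $E'$ are uncolored. Extending $f$ to a set of edges means assigning labels to them so that the result is again a partial $2$-tone edge $k$-coloring. -}

module Defs where

open import Data.Nat using (ℕ; zero; suc; _+_; _≤_; _<_)
open import Data.Fin using (Fin; _≟_) renaming (_<_ to _<ᶠ_)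
open import Data.Bool using (Bool; true; false; if_then_else_; _∨_)
open import Data.List using (List; map; allFin)
open import Data.Nat.ListAction using (sum)
open import Data.Maybe using (Maybe; just; nothing)
open import Data.Product using (Σ; _×_; _,_; ∃)
open import Data.Sum using (_⊎_)
open import Relation.Nullary using (¬_; does)
open import Relation.Binary.PropositionalEquality using (_≡_; _≢_)

record Graph : Set where
  field
    n      : ℕ
    adj    : Fin n → Fin n → Bool
    sym    : ∀ u v → adj u v ≡ adj v u
    irrefl : ∀ u → adj u u ≡ false
open Graph public

deg : (G : Graph) → Fin (n G) → ℕ
deg G u = sum (map (λ v → if adj G u v then 1 else 0) (allFin (n G)))

Subcubic : Graph → Set
Subcubic G = ∀ u → deg G u ≤ 3

-- An edge {u,v}, stored canonically with u < v.
record Edge (G : Graph) : Set where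
  constructor edge
  field
    ends₁ : Fin (n G)
    ends₂ : Fin (n G)
    ordered : ends₁ <ᶠ ends₂
    isEdge  : adj G ends₁ ends₂ ≡ true
open Edge public

_∈ₑ_ : {G : Graph} → Fin (n G) → Edge G → Set
w ∈ₑ e = (w ≡ ends₁ e) ⊎ (w ≡ ends₂ e)

LAdj : {G : Graph} → Edge G → Edge G → Set
LAdj e e' = (e ≢ e') × ∃ λ w → (w ∈ₑ e) × (w ∈ₑ e')

-- DistLe e e' k  ⇔  d_G(e,e') ≤ k, i.e. there is a walk of length ≤ k
-- from e to e' in the line graph.
data DistLe {G : Graph} : Edge G → Edge G → ℕ → Set where
  here : ∀ {e k} → DistLe e e k
  step : ∀ {e e' e'' k} → LAdj e e' → DistLe e' e'' k → DistLe e e'' (suc k)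

-- A label: a 2-element subset {a,b} of the k colours, with a < b.
record Label (k : ℕ) : Set where
  constructor lab
  field
    c₁ : Fin k
    c₂ : Fin k
    c₁<c₂ : c₁ <ᶠ c₂
open Label public

private
  b2n : Bool → ℕ
  b2n true = 1
  b2n false = 0

∣_∩_∣ : {k : ℕ} → Label k → Label k → ℕ
∣ A ∩ B ∣ = b2n (does (c₁ A ≟ c₁ B) ∨ does (c₁ A ≟ c₂ B))
          + b2n (does (c₂ A ≟ c₁ B) ∨ does (c₂ A ≟ c₂ B))

PartialLabelling : Graph → ℕ → Set
PartialLabelling G k = Edge G → Maybe (Label k)

-- partial 2-tone edge k-colouring: for distinct coloured edges e, e',
-- |f(e) ∩ f(e')| < d_G(e,e'), i.e. not (d_G(e,e') ≤ |f(e) ∩ f(e')|)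
-- (with d = ∞ for edges in different components).
Is2Tone : {G : Graph} {k : ℕ} → PartialLabelling G k → Set
Is2Tone {G} f = ∀ (e e' : Edge G) (A B : Label _) → e ≢ e' →
  f e ≡ just A → f e' ≡ just B → ¬ DistLe e e' ∣ A ∩ B ∣

-- The two new edges uv and uw need labels L₁, L₂ that are disjoint from each other; L₁ must be
-- disjoint from the (at most two) labels at v and differ from the labels at distance two from uv,
-- namely those at w and those one step beyond v: at most 2 + 4 labels.  Let P, Q be the colours
-- used at v and w, so |P|, |Q| ≤ 4.  Among the C(10 − |P|, 2) ≥ 15 labels avoiding P one fits uv;
-- L₂ is then sought among the C(10 − |Q ∪ L₁|, 2) labels avoiding Q ∪ L₁.  These outnumber its
-- at most six forbidden labels when |Q ∪ L₁| ≤ 5, and also when |Q ∪ L₁| = 6 but a label at v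
-- meets Q (that label is then no candidate).  Otherwise P and Q are disjoint with |Q| = 4, and L₁
-- is chosen among the C(10 − |P|, 2) − C(6 − |P|, 2) ≥ 14 labels avoiding P but meeting Q, so that
-- |Q ∪ L₁| ≤ 5.  Subcubicity bounds the numbers of nearby labels, and every coloured edge at
-- distance one or two from a new edge carries one of them.

module Submission where

open import Defs renaming (sym to adj-sym)
open import Data.Nat using (ℕ; zero; suc; _+_; _*_; _∸_; _≤_; _<_; z≤n; s≤s; _≤?_)
  renaming (_≟_ to _≟ℕ_)
open import Data.Nat.Properties
  using (≤-refl; ≤-reflexive; ≤-trans; <-≤-trans; ≤-antisym; ≤-pred; ≰⇒>; ≤ᵇ⇒≤; m≤n⇒m<n∨m≡n;
         m≤n⇒m≤1+n; m≤n+m; +-suc; +-comm; +-mono-≤; +-monoˡ-≤; +-monoʳ-≤; +-cancelʳ-≤; *-mono-≤;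
         *-monoʳ-≤; *-distribˡ-+; ∸-monoʳ-≤; module ≤-Reasoning)
open import Data.Nat.ListAction using (sum)
open import Data.Nat.Combinatorics using (_C_; nCk+nC[k+1]≡[n+1]C[k+1])
open import Data.Fin using (Fin; zero; _≟_; _<?_) renaming (_<_ to _<ᶠ_)
open import Data.Fin.Properties using (<-irrelevant; <⇒≢; <-asym; <-cmp)
open import Data.Fin.Subset using (Subset; inside; outside; ⊥; ⁅_⁆; _∪_; ∣_∣; _⊆_; Empty)
  renaming (_∩_ to _∩ₛ_; _∈_ to _∈ₛ_; _∉_ to _∉ₛ_)
open import Data.Fin.Subset.Properties
  using (x∈⁅x⁆; x∈⁅y⁆⇒x≡y; x∈p∪q⁺; x∈p∪q⁻; x∈p∩q⁻; p⊆p∪q; q⊆p∪q; ∣⁅x⁆∣≡1; ∣⊥∣≡0; ∉⊥;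
         p⊆q⇒∣p∣≤∣q∣; drop-∷-Empty; anySubset?)
  renaming (_∈?_ to _∈ₛ?_)
open import Data.Bool using (Bool; true; false; _∨_; if_then_else_)
import Data.Bool.Properties as Bool
open import Data.Vec using ([]; _∷_; here; there)
open import Data.List
  using (List; []; _∷_; _++_; length; filter; map; mapMaybe; concatMap; cartesianProduct; allFin)
open import Data.List.Properties
  using (length-++; length-filter; length-mapMaybe; filter-++; filter-notAll; filter-complete)
open import Data.List.Membership.Propositional using (_∈_; _∉_)
open import Data.List.Membership.Propositional.Properties
  using (∈-filter⁺; ∈-filter⁻; ∈-allFin; ∈-concatMap⁺; ∈-++⁺ˡ; ∈-++⁺ʳ)
open import Data.List.Relation.Unary.Any as Any using (here; there)
open import Data.List.Relation.Unary.Any.Properties using (mapMaybe⁺; map⁺)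
open import Data.List.Relation.Unary.All as All using (All; []; _∷_)
open import Data.List.Relation.Unary.All.Properties using (all-filter)
open import Data.List.Relation.Unary.AllPairs using (_∷_)
open import Data.List.Relation.Unary.Unique.Propositional using (Unique)
import Data.List.Relation.Unary.Unique.Propositional.Properties as Unique
open import Data.List.Relation.Unary.Unique.DecPropositional using (unique?)
open import Data.List.Relation.Binary.Sublist.Heterogeneous.Properties using (length-mono-≤; ⊆-filter-Sublist)
open import Data.List.Relation.Binary.Sublist.Propositional using () renaming (⊆-refl to sublist-refl)
open import Data.Maybe using (Maybe; just; nothing)
import Data.Maybe as Maybe
open import Data.Maybe.Relation.Unary.Any as MaybeAny using (just)
open import Data.Sum as Sum using (_⊎_; inj₁; inj₂)
open import Data.Product using (_×_; _,_; ∃; ∃₂; ∃-syntax; proj₁; proj₂; uncurry)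
open import Function using (_∘_)
open import Relation.Nullary using (¬_; Dec; yes; no; does; contradiction)
open import Relation.Nullary.Decidable
  using (¬?; _×-dec_; _⊎-dec_; dec⇒maybe; dec-true; dec-false; from-yes; from-no; decidable-stable)
open import Relation.Unary using (Pred; Decidable)
open import Relation.Binary using (tri<; tri≈; tri>)
open import Relation.Binary.Definitions using (DecidableEquality)
open import Relation.Binary.PropositionalEquality
open import Axiom.UniquenessOfIdentityProofs using (module Decidable⇒UIP)

private variable
  k : ℕ
  A B : Label k
  c : Fin k
  S T : Subset k

module _ {a} {X : Set a} where

  length-filter-mono : ∀ {p q} {P : Pred X p} {Q : Pred X q} (P? : Decidable P) (Q? : Decidable Q) →
                       (∀ {x} → P x → Q x) → ∀ xs → length (filter P? xs) ≤ length (filter Q? xs)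
  length-filter-mono P? Q? P⇒Q xs =
    length-mono-≤ (⊆-filter-Sublist P? Q? (λ { refl → P⇒Q }) (sublist-refl {x = xs}))

  length-filter-split : ∀ {p q} {P : Pred X p} {Q : Pred X q} (P? : Decidable P) (Q? : Decidable Q) xs →
                        length (filter P? xs) ≡
                        length (filter (λ x → P? x ×-dec Q? x) xs) +
                        length (filter (λ x → P? x ×-dec ¬? (Q? x)) xs)
  length-filter-split P? Q? []       = refl
  length-filter-split P? Q? (x ∷ xs) with P? x | Q? x
  ... | yes _ | yes _ = cong suc (length-filter-split P? Q? xs)
  ... | yes _ | no _  = trans (cong suc (length-filter-split P? Q? xs)) (sym (+-suc _ _))
  ... | no _  | _     = length-filter-split P? Q? xs

  sum-indicator≡length-filter : (p : X → Bool) (xs : List X) →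
    sum (map (λ x → if p x then 1 else 0) xs) ≡ length (filter (λ x → p x Bool.≟ true) xs)
  sum-indicator≡length-filter p []       = refl
  sum-indicator≡length-filter p (x ∷ xs) with p x
  ... | true  = cong suc (sum-indicator≡length-filter p xs)
  ... | false = sum-indicator≡length-filter p xs

  module _ (_≟_ : DecidableEquality X) where
    open import Data.List.Membership.DecPropositional _≟_ using (_∈?_)

    pigeonhole : {xs ys : List X} → Unique xs → length ys < length xs → ∃[ x ] x ∈ xs × x ∉ ys
    pigeonhole {x ∷ xs} {ys} (x≢xs ∷ xs!) (s≤s ∣ys∣≤∣xs∣) with x ∈? ys
    ... | no x∉ys  = x , here refl , x∉ys
    ... | yes x∈ys =
      let y , y∈xs , y∉ys-x = pigeonhole xs! (<-≤-trans fewer ∣ys∣≤∣xs∣)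
      in  y , there y∈xs , λ y∈ys → y∉ys-x (∈-filter⁺ (λ y → ¬? (y ≟ x)) y∈ys (All.lookup x≢xs y∈xs ∘ sym))
      where
      fewer : length (filter (λ y → ¬? (y ≟ x)) ys) < length ys
      fewer = filter-notAll (λ y → ¬? (y ≟ x)) ys (Any.map (λ { refl y≢x → y≢x refl }) x∈ys)

    pigeonhole-filter : ∀ {p} {P : Pred X p} (P? : Decidable P) {xs ys : List X} → Unique xs →
                        length (filter P? ys) < length (filter P? xs) → ∃[ x ] P x × x ∉ ys
    pigeonhole-filter P? {xs} xs! fewer =
      let x , x∈xs , x∉ys = pigeonhole {filter P? xs} (Unique.filter⁺ P? xs!) fewer
          Px = proj₂ (∈-filter⁻ P? {xs = xs} x∈xs)
      in  x , Px , λ x∈ys → x∉ys (∈-filter⁺ P? x∈ys Px)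

module _ {a b} {X : Set a} {Y : Set b} where

  ∈-mapMaybe⁺ : {f : X → Maybe Y} {x : X} {y : Y} (xs : List X) → x ∈ xs → f x ≡ just y →
                y ∈ mapMaybe f xs
  ∈-mapMaybe⁺ {f = f} xs x∈xs fx≡y =
    mapMaybe⁺ f xs (map⁺ (Any.map (λ { refl → subst (MaybeAny.Any _) (sym fx≡y) (just refl) }) x∈xs))

  length-concatMap≤ : ∀ {m} (f : X → List Y) (xs : List X) → (∀ {x} → x ∈ xs → length (f x) ≤ m) →
                      length (concatMap f xs) ≤ length xs * m
  length-concatMap≤ f []       _  = z≤n
  length-concatMap≤ f (x ∷ xs) ≤m = ≤-trans (≤-reflexive (length-++ (f x)))
                                            (+-mono-≤ (≤m (here refl)) (length-concatMap≤ f xs (≤m ∘ there)))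

∣p∪q∣≤∣p∣+∣q∣ : ∀ {n} (p q : Subset n) → ∣ p ∪ q ∣ ≤ ∣ p ∣ + ∣ q ∣
∣p∪q∣≤∣p∣+∣q∣ []            []            = z≤n
∣p∪q∣≤∣p∣+∣q∣ (inside  ∷ p) (inside  ∷ q) =
  s≤s (≤-trans (m≤n⇒m≤1+n (∣p∪q∣≤∣p∣+∣q∣ p q)) (≤-reflexive (sym (+-suc _ _))))
∣p∪q∣≤∣p∣+∣q∣ (inside  ∷ p) (outside ∷ q) = s≤s (∣p∪q∣≤∣p∣+∣q∣ p q)
∣p∪q∣≤∣p∣+∣q∣ (outside ∷ p) (inside  ∷ q) = ≤-trans (s≤s (∣p∪q∣≤∣p∣+∣q∣ p q)) (≤-reflexive (sym (+-suc _ _)))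
∣p∪q∣≤∣p∣+∣q∣ (outside ∷ p) (outside ∷ q) = ∣p∪q∣≤∣p∣+∣q∣ p q

∣p∪q∣≡∣p∣+∣q∣ : ∀ {n} (p q : Subset n) → Empty (p ∩ₛ q) → ∣ p ∪ q ∣ ≡ ∣ p ∣ + ∣ q ∣
∣p∪q∣≡∣p∣+∣q∣ []            []            _ = refl
∣p∪q∣≡∣p∣+∣q∣ (inside  ∷ p) (inside  ∷ q) ∅ = contradiction (zero , here) ∅
∣p∪q∣≡∣p∣+∣q∣ (inside  ∷ p) (outside ∷ q) ∅ = cong suc (∣p∪q∣≡∣p∣+∣q∣ p q (drop-∷-Empty ∅))
∣p∪q∣≡∣p∣+∣q∣ (outside ∷ p) (inside  ∷ q) ∅ =
  trans (cong suc (∣p∪q∣≡∣p∣+∣q∣ p q (drop-∷-Empty ∅))) (sym (+-suc _ _))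
∣p∪q∣≡∣p∣+∣q∣ (outside ∷ p) (outside ∷ q) ∅ = ∣p∪q∣≡∣p∣+∣q∣ p q (drop-∷-Empty ∅)

∣p∪q∣≤1+∣p∣ : ∀ {n} (p q : Subset n) {x} → q ⊆ p ∪ ⁅ x ⁆ → ∣ p ∪ q ∣ ≤ suc ∣ p ∣
∣p∪q∣≤1+∣p∣ p q {x} q⊆p+x = begin
  ∣ p ∪ q ∣          ≤⟨ p⊆q⇒∣p∣≤∣q∣ p∪q⊆p+x ⟩
  ∣ p ∪ ⁅ x ⁆ ∣      ≤⟨ ∣p∪q∣≤∣p∣+∣q∣ p ⁅ x ⁆ ⟩
  ∣ p ∣ + ∣ ⁅ x ⁆ ∣  ≡⟨ cong (∣ p ∣ +_) (∣⁅x⁆∣≡1 x) ⟩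
  ∣ p ∣ + 1          ≡⟨ +-comm ∣ p ∣ 1 ⟩
  suc ∣ p ∣          ∎
  where
  open ≤-Reasoning
  p∪q⊆p+x : p ∪ q ⊆ p ∪ ⁅ x ⁆
  p∪q⊆p+x y∈p∪q with x∈p∪q⁻ p q y∈p∪q
  ... | inj₁ y∈p = p⊆p∪q ⁅ x ⁆ y∈p
  ... | inj₂ y∈q = q⊆p+x y∈q

Label-≡ : c₁ A ≡ c₁ B → c₂ A ≡ c₂ B → A ≡ B
Label-≡ {A = lab a b a<b} {lab .a .b a<b′} refl refl = cong (lab a b) (<-irrelevant a<b a<b′)

_≟ₗ_ : DecidableEquality (Label k)
A ≟ₗ B with c₁ A ≟ c₁ B | c₂ A ≟ c₂ B
... | yes p | yes q = yes (Label-≡ p q)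
... | no p  | _     = no (p ∘ cong c₁)
... | _     | no q  = no (q ∘ cong c₂)

-- In Defs, ∣ A ∩ B ∣ is [c₁ A ∈ᵇ B] + [c₂ A ∈ᵇ B]; its bounds come from case analysis on these Booleans.
_∈ᵇ_ : Fin k → Label k → Bool
c ∈ᵇ B = does (c ≟ c₁ B) ∨ does (c ≟ c₂ B)

∈ᵇ⇒ : c ∈ᵇ B ≡ true → c ≡ c₁ B ⊎ c ≡ c₂ B
∈ᵇ⇒ {c = c} {B = B} c∈B with c ≟ c₁ B | c ≟ c₂ B
∈ᵇ⇒ _  | yes p | _     = inj₁ p
∈ᵇ⇒ _  | no _  | yes q = inj₂ q
∈ᵇ⇒ () | no _  | no _

∈ᵇ-both⇒≡ : c₁ A ∈ᵇ B ≡ true → c₂ A ∈ᵇ B ≡ true → A ≡ B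
∈ᵇ-both⇒≡ {A = A} {B = B} h₁ h₂ with ∈ᵇ⇒ {B = B} h₁ | ∈ᵇ⇒ {B = B} h₂
... | inj₁ p | inj₁ q = contradiction (trans p (sym q)) (<⇒≢ (c₁<c₂ A))
... | inj₁ p | inj₂ q = Label-≡ p q
... | inj₂ p | inj₁ q = contradiction (subst₂ _<ᶠ_ p q (c₁<c₂ A)) (<-asym (c₁<c₂ B))
... | inj₂ p | inj₂ q = contradiction (trans p (sym q)) (<⇒≢ (c₁<c₂ A))

∣A∩B∣≤2 : (A B : Label k) → ∣ A ∩ B ∣ ≤ 2
∣A∩B∣≤2 A B with c₁ A ∈ᵇ B | c₂ A ∈ᵇ B
... | true  | true  = s≤s (s≤s z≤n)
... | true  | false = s≤s z≤n
... | false | true  = s≤s z≤n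
... | false | false = z≤n

A≢B⇒∣A∩B∣≤1 : A ≢ B → ∣ A ∩ B ∣ ≤ 1
A≢B⇒∣A∩B∣≤1 {A = A} {B = B} A≢B with c₁ A ∈ᵇ B in h₁ | c₂ A ∈ᵇ B in h₂
... | true  | true  = contradiction (∈ᵇ-both⇒≡ h₁ h₂) A≢B
... | true  | false = s≤s z≤n
... | false | true  = s≤s z≤n
... | false | false = z≤n

colours : Label k → Subset k
colours A = ⁅ c₁ A ⁆ ∪ ⁅ c₂ A ⁆

c₁∈colours : (A : Label k) → c₁ A ∈ₛ colours A
c₁∈colours _ = x∈p∪q⁺ (inj₁ (x∈⁅x⁆ _))

c₂∈colours : (A : Label k) → c₂ A ∈ₛ colours A
c₂∈colours _ = x∈p∪q⁺ (inj₂ (x∈⁅x⁆ _))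

∈colours⁻ : c ∈ₛ colours A → c ≡ c₁ A ⊎ c ≡ c₂ A
∈colours⁻ {A = A} c∈A with x∈p∪q⁻ ⁅ c₁ A ⁆ ⁅ c₂ A ⁆ c∈A
... | inj₁ c∈₁ = inj₁ (x∈⁅y⁆⇒x≡y _ c∈₁)
... | inj₂ c∈₂ = inj₂ (x∈⁅y⁆⇒x≡y _ c∈₂)

Avoids : Label k → Subset k → Set
Avoids A S = c₁ A ∉ₛ S × c₂ A ∉ₛ S

avoids? : (A : Label k) (S : Subset k) → Dec (Avoids A S)
avoids? A S = ¬? (c₁ A ∈ₛ? S) ×-dec ¬? (c₂ A ∈ₛ? S)

Disjoint : Label k → Label k → Set
Disjoint A B = Avoids A (colours B)

Disjoint-sym : Disjoint A B → Disjoint B A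
Disjoint-sym {A = A} {B = B} (c₁∉B , c₂∉B) = ∉A (c₁∈colours B) , ∉A (c₂∈colours B)
  where
  ∉A : c ∈ₛ colours B → c ∉ₛ colours A
  ∉A c∈B c∈A with ∈colours⁻ {A = A} c∈A
  ... | inj₁ refl = c₁∉B c∈B
  ... | inj₂ refl = c₂∉B c∈B

Disjoint⇒≢ : Disjoint A B → A ≢ B
Disjoint⇒≢ {A = A} (c₁∉A , _) refl = c₁∉A (c₁∈colours A)

∉colours⇒∈ᵇ≡false : c ∉ₛ colours B → c ∈ᵇ B ≡ false
∉colours⇒∈ᵇ≡false {c = c} {B = B} c∉B with c ∈ᵇ B in c∈B
... | false = refl
... | true with ∈ᵇ⇒ {c = c} {B = B} c∈B
...   | inj₁ refl = contradiction (c₁∈colours B) c∉B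
...   | inj₂ refl = contradiction (c₂∈colours B) c∉B

Disjoint⇒∣A∩B∣≡0 : Disjoint A B → ∣ A ∩ B ∣ ≡ 0
Disjoint⇒∣A∩B∣≡0 {A = A} {B = B} (c₁∉B , c₂∉B)
  rewrite ∉colours⇒∈ᵇ≡false {B = B} c₁∉B | ∉colours⇒∈ᵇ≡false {B = B} c₂∉B = refl

coloursOf : List (Label k) → Subset k
coloursOf []       = ⊥
coloursOf (B ∷ Bs) = colours B ∪ coloursOf Bs

colours⊆coloursOf : {Bs : List (Label k)} → B ∈ Bs → colours B ⊆ coloursOf Bs
colours⊆coloursOf {Bs = B′ ∷ Bs} (here refl) = p⊆p∪q (coloursOf Bs)
colours⊆coloursOf {Bs = B′ ∷ Bs} (there B∈Bs) = q⊆p∪q (colours B′) _ ∘ colours⊆coloursOf B∈Bs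

∈coloursOf⁻ : (Bs : List (Label k)) → c ∈ₛ coloursOf Bs → ∃[ B ] B ∈ Bs × c ∈ₛ colours B
∈coloursOf⁻ []       c∈ = contradiction c∈ ∉⊥
∈coloursOf⁻ (B ∷ Bs) c∈ with x∈p∪q⁻ (colours B) (coloursOf Bs) c∈
... | inj₁ c∈B  = B , here refl , c∈B
... | inj₂ c∈Bs with ∈coloursOf⁻ Bs c∈Bs
...   | B′ , B′∈Bs , c∈B′ = B′ , there B′∈Bs , c∈B′

∣colours∣≤2 : (A : Label k) → ∣ colours A ∣ ≤ 2
∣colours∣≤2 A = ≤-trans (∣p∪q∣≤∣p∣+∣q∣ ⁅ c₁ A ⁆ ⁅ c₂ A ⁆)
                        (≤-reflexive (cong₂ _+_ (∣⁅x⁆∣≡1 (c₁ A)) (∣⁅x⁆∣≡1 (c₂ A))))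

∣coloursOf∣≤2*length : (Bs : List (Label k)) → ∣ coloursOf Bs ∣ ≤ 2 * length Bs
∣coloursOf∣≤2*length {k} [] = ≤-reflexive (∣⊥∣≡0 k)
∣coloursOf∣≤2*length (B ∷ Bs) = begin
  ∣ colours B ∪ coloursOf Bs ∣       ≤⟨ ∣p∪q∣≤∣p∣+∣q∣ (colours B) (coloursOf Bs) ⟩
  ∣ colours B ∣ + ∣ coloursOf Bs ∣   ≤⟨ +-mono-≤ (∣colours∣≤2 B) (∣coloursOf∣≤2*length Bs) ⟩
  2 + 2 * length Bs                  ≡⟨ sym (*-distribˡ-+ 2 1 (length Bs)) ⟩
  2 * length (B ∷ Bs)                ∎
  where open ≤-Reasoning

Avoids⇒∉ : Avoids A S → c ∈ₛ colours A → c ∉ₛ S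
Avoids⇒∉ {A = A} (c₁∉S , c₂∉S) c∈A with ∈colours⁻ {A = A} c∈A
... | inj₁ refl = c₁∉S
... | inj₂ refl = c₂∉S

Avoids-⊆ : S ⊆ T → Avoids A T → Avoids A S
Avoids-⊆ S⊆T (c₁∉T , c₂∉T) = c₁∉T ∘ S⊆T , c₂∉T ∘ S⊆T

Avoids-∪ : Avoids A S → Avoids A T → Avoids A (S ∪ T)
Avoids-∪ {S = S} {T = T} A∉S A∉T = ∉∪ (proj₁ A∉S) (proj₁ A∉T) , ∉∪ (proj₂ A∉S) (proj₂ A∉T)
  where
  ∉∪ : c ∉ₛ S → c ∉ₛ T → c ∉ₛ S ∪ T
  ∉∪ c∉S c∉T c∈S∪T with x∈p∪q⁻ S T c∈S∪T
  ... | inj₁ c∈S = c∉S c∈S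
  ... | inj₂ c∈T = c∉T c∈T

¬Avoids⇒∣S∪colours∣≤1+∣S∣ : ¬ Avoids A S → ∣ S ∪ colours A ∣ ≤ suc ∣ S ∣
¬Avoids⇒∣S∪colours∣≤1+∣S∣ {A = A} {S = S} meets with c₁ A ∈ₛ? S | c₂ A ∈ₛ? S
... | yes c₁∈S | _        = ∣p∪q∣≤1+∣p∣ S (colours A)
  (x∈p∪q⁺ ∘ Sum.map (λ { refl → c₁∈S }) (λ { refl → x∈⁅x⁆ (c₂ A) }) ∘ ∈colours⁻ {A = A})
... | no _     | yes c₂∈S = ∣p∪q∣≤1+∣p∣ S (colours A)
  (x∈p∪q⁺ ∘ Sum.map (λ { refl → c₂∈S }) (λ { refl → x∈⁅x⁆ (c₁ A) }) ∘ Sum.swap ∘ ∈colours⁻ {A = A})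
... | no c₁∉S  | no c₂∉S  = contradiction (c₁∉S , c₂∉S) meets

allLabels : List (Label k)
allLabels {k} = mapMaybe (uncurry orderedLabel) (cartesianProduct (allFin k) (allFin k))
  where
  orderedLabel : Fin k → Fin k → Maybe (Label k)
  orderedLabel a b = Maybe.map (lab a b) (dec⇒maybe (a <? b))

avoiding : Subset k → List (Label k)
avoiding S = filter (λ A → avoids? A S) allLabels

-- Both facts are checked by evaluation, the second over all 2¹⁰ colour sets.  They are opaque
-- because unfolding these evaluated proofs during conversion checking is prohibitively slow.
opaque
  allLabels-unique : Unique (allLabels {10})
  allLabels-unique = from-yes (unique? _≟ₗ_ (allLabels {10}))

  ∣avoiding∣ : (S : Subset 10) → length (avoiding S) ≡ (10 ∸ ∣ S ∣) C 2
  ∣avoiding∣ S = decidable-stable (length (avoiding S) ≟ℕ (10 ∸ ∣ S ∣) C 2) λ ≢ →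
    from-no (anySubset? {n = 10} λ S → ¬? (length (avoiding S) ≟ℕ (10 ∸ ∣ S ∣) C 2)) (S , ≢)

nC2≤[1+n]C2 : ∀ n → n C 2 ≤ suc n C 2
nC2≤[1+n]C2 n = begin
  n C 2           ≤⟨ m≤n+m (n C 2) (n C 1) ⟩
  n C 1 + n C 2   ≡⟨ nCk+nC[k+1]≡[n+1]C[k+1] n 1 ⟩
  suc n C 2       ∎
  where open ≤-Reasoning

C2-mono : ∀ {m n} → m ≤ n → m C 2 ≤ n C 2
C2-mono {n = zero}  z≤n = ≤-refl
C2-mono {n = suc n} m≤1+n with m≤n⇒m<n∨m≡n m≤1+n
... | inj₁ m<1+n = ≤-trans (C2-mono (≤-pred m<1+n)) (nC2≤[1+n]C2 n)
... | inj₂ refl  = ≤-refl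

∣avoiding∣≥ : ∀ {m} (S : Subset 10) → ∣ S ∣ ≤ m → (10 ∸ m) C 2 ≤ length (avoiding S)
∣avoiding∣≥ S ∣S∣≤m = ≤-trans (C2-mono (∸-monoʳ-≤ 10 ∣S∣≤m)) (≤-reflexive (sym (∣avoiding∣ S)))

∣avoiding∣≤ : ∀ {m} (S : Subset 10) → m ≤ ∣ S ∣ → length (avoiding S) ≤ (10 ∸ m) C 2
∣avoiding∣≤ S m≤∣S∣ = ≤-trans (≤-reflexive (∣avoiding∣ S)) (C2-mono (∸-monoʳ-≤ 10 m≤∣S∣))

-- Choosing the two labels

7+[10∸[p+4]]C2≤[10∸p]C2 : ∀ {p} → p ≤ 4 → 7 + (10 ∸ (p + 4)) C 2 ≤ (10 ∸ p) C 2
7+[10∸[p+4]]C2≤[10∸p]C2 z≤n                             = ≤ᵇ⇒≤ 22 45 _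
7+[10∸[p+4]]C2≤[10∸p]C2 (s≤s z≤n)                       = ≤ᵇ⇒≤ 17 36 _
7+[10∸[p+4]]C2≤[10∸p]C2 (s≤s (s≤s z≤n))                 = ≤ᵇ⇒≤ 13 28 _
7+[10∸[p+4]]C2≤[10∸p]C2 (s≤s (s≤s (s≤s z≤n)))           = ≤ᵇ⇒≤ 10 21 _
7+[10∸[p+4]]C2≤[10∸p]C2 (s≤s (s≤s (s≤s (s≤s z≤n))))     = ≤ᵇ⇒≤ 8 15 _

-- near and far hold the labels at distance one and two from the edge that is to receive L.
Fits : Label k → List (Label k) → List (Label k) → Set
Fits L near far = (∀ {B} → B ∈ near → Disjoint L B) × L ∉ far

module _ (Nv Nw Fv Fw : List (Label 10))
         (∣Nv∣≤2 : length Nv ≤ 2) (∣Nw∣≤2 : length Nw ≤ 2) (∣Fv∣≤4 : length Fv ≤ 4) (∣Fw∣≤4 : length Fw ≤ 4)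
         where

  private
    P Q : Subset 10
    P = coloursOf Nv
    Q = coloursOf Nw

    ∣P∣≤4 : ∣ P ∣ ≤ 4
    ∣P∣≤4 = ≤-trans (∣coloursOf∣≤2*length Nv) (*-monoʳ-≤ 2 ∣Nv∣≤2)

    ∣Q∣≤4 : ∣ Q ∣ ≤ 4
    ∣Q∣≤4 = ≤-trans (∣coloursOf∣≤2*length Nw) (*-monoʳ-≤ 2 ∣Nw∣≤2)

    ∣filter∣≤6 : ∀ {p} {R : Pred (Label 10) p} (R? : Decidable R) (xs ys : List (Label 10)) →
                 length xs ≤ 2 → length ys ≤ 4 → length (filter R? (xs ++ ys)) ≤ 6
    ∣filter∣≤6 R? xs ys ∣xs∣≤2 ∣ys∣≤4 = begin
      length (filter R? (xs ++ ys))  ≤⟨ length-filter R? (xs ++ ys) ⟩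
      length (xs ++ ys)              ≡⟨ length-++ xs ⟩
      length xs + length ys          ≤⟨ +-mono-≤ ∣xs∣≤2 ∣ys∣≤4 ⟩
      6                              ∎
      where open ≤-Reasoning

    pickLabel : ∀ {p} {R : Pred (Label 10) p} (R? : Decidable R) (bad : List (Label 10)) →
                length (filter R? bad) < length (filter R? allLabels) → ∃[ L ] R L × L ∉ bad
    pickLabel R? bad = pigeonhole-filter _≟ₗ_ R? allLabels-unique

    pickAvoiding : (S : Subset 10) (bad : List (Label 10)) →
                   length (filter (λ L → avoids? L S) bad) < length (avoiding S) →
                   ∃[ L ] Avoids L S × L ∉ bad
    pickAvoiding S = pickLabel (λ L → avoids? L S)

    fewer₁ : length (filter (λ L → avoids? L P) (Nw ++ Fv)) < length (avoiding P)
    fewer₁ = ≤-trans (s≤s (∣filter∣≤6 (λ L → avoids? L P) Nw Fv ∣Nw∣≤2 ∣Fv∣≤4))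
                     (≤-trans (≤ᵇ⇒≤ 7 15 _) (∣avoiding∣≥ P ∣P∣≤4))

    Avoids⇒Fits : (L : Label 10) → Avoids L P → L ∉ Nw ++ Fv → Fits L Nv (Nw ++ Fv)
    Avoids⇒Fits L L∉P L∉bad = (λ B∈Nv → Avoids-⊆ {A = L} (colours⊆coloursOf B∈Nv) L∉P) , L∉bad

    firstLabel : ∃[ L₁ ] Fits L₁ Nv (Nw ++ Fv)
    firstLabel =
      let L₁ , L₁∉P , L₁∉bad = pickAvoiding P (Nw ++ Fv) fewer₁
      in  L₁ , Avoids⇒Fits L₁ L₁∉P L₁∉bad

    avoidsQ? : Decidable (λ B → Avoids B Q)
    avoidsQ? B = avoids? B Q

    S₂ : Label 10 → Subset 10
    S₂ L₁ = Q ∪ colours L₁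

    RoomForSecond : Label 10 → Set
    RoomForSecond L₁ = length (filter (λ L → avoids? L (S₂ L₁)) (Nv ++ Fw)) < length (avoiding (S₂ L₁))

    secondLabel : (L₁ : Label 10) → RoomForSecond L₁ → ∃[ L₂ ] Disjoint L₂ L₁ × Fits L₂ Nw (Nv ++ Fw)
    secondLabel L₁ fewer =
      let L₂ , L₂∉S₂ , L₂∉bad = pickAvoiding (S₂ L₁) (Nv ++ Fw) fewer
      in  L₂ , Avoids-⊆ {A = L₂} (q⊆p∪q Q (colours L₁)) L₂∉S₂ ,
          (λ B∈Nw → Avoids-⊆ {A = L₂} (p⊆p∪q (colours L₁) ∘ colours⊆coloursOf B∈Nw) L₂∉S₂) , L₂∉bad

    ∣S₂∣≤∣Q∣+2 : (L₁ : Label 10) → ∣ S₂ L₁ ∣ ≤ ∣ Q ∣ + 2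
    ∣S₂∣≤∣Q∣+2 L₁ = ≤-trans (∣p∪q∣≤∣p∣+∣q∣ Q (colours L₁)) (+-monoʳ-≤ ∣ Q ∣ (∣colours∣≤2 L₁))

    room-small : (L₁ : Label 10) → ∣ S₂ L₁ ∣ ≤ 5 → RoomForSecond L₁
    room-small L₁ ∣S₂∣≤5 = ≤-trans (s≤s (∣filter∣≤6 (λ L → avoids? L (S₂ L₁)) Nv Fw ∣Nv∣≤2 ∣Fw∣≤4))
                                   (≤-trans (≤ᵇ⇒≤ 7 10 _) (∣avoiding∣≥ (S₂ L₁) ∣S₂∣≤5))

    -- Six colours in S₂ leave only six candidates, but fewer than two labels of Nv are among them.
    room-few : (L₁ : Label 10) → length (filter avoidsQ? Nv) ≤ 1 → RoomForSecond L₁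
    room-few L₁ few = begin-strict
      length (filter avoidsS₂? (Nv ++ Fw))                         ≡⟨ cong length (filter-++ avoidsS₂? Nv Fw) ⟩
      length (filter avoidsS₂? Nv ++ filter avoidsS₂? Fw)          ≡⟨ length-++ (filter avoidsS₂? Nv) ⟩
      length (filter avoidsS₂? Nv) + length (filter avoidsS₂? Fw)  ≤⟨ +-mono-≤ inNv inFw ⟩
      5                                                            <⟨ ≤ᵇ⇒≤ 6 6 _ ⟩
      6                                                            ≤⟨ ∣avoiding∣≥ (S₂ L₁) ∣S₂∣≤6 ⟩
      length (avoiding (S₂ L₁))                                    ∎
      where
      open ≤-Reasoning
      avoidsS₂? = λ L → avoids? L (S₂ L₁)
      inNv : length (filter avoidsS₂? Nv) ≤ 1
      inNv = ≤-trans (length-filter-mono avoidsS₂? avoidsQ? (λ {B} → Avoids-⊆ {A = B} (p⊆p∪q (colours L₁))) Nv)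
                     few
      inFw : length (filter avoidsS₂? Fw) ≤ 4
      inFw = ≤-trans (length-filter avoidsS₂? Fw) ∣Fw∣≤4
      ∣S₂∣≤6 : ∣ S₂ L₁ ∣ ≤ 6
      ∣S₂∣≤6 = ≤-trans (∣S₂∣≤∣Q∣+2 L₁) (+-monoˡ-≤ 2 ∣Q∣≤4)

    avoidsP∧meetsQ? : Decidable (λ L → Avoids L P × ¬ Avoids L Q)
    avoidsP∧meetsQ? L = avoids? L P ×-dec ¬? (avoids? L Q)

    7≤∣avoidsP∧meetsQ∣ : Empty (P ∩ₛ Q) → 4 ≤ ∣ Q ∣ → 7 ≤ length (filter avoidsP∧meetsQ? allLabels)
    7≤∣avoidsP∧meetsQ∣ P∩Q≡∅ 4≤∣Q∣ = +-cancelʳ-≤ rest 7 X (begin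
      7 + rest                                  ≤⟨ 7+[10∸[p+4]]C2≤[10∸p]C2 ∣P∣≤4 ⟩
      (10 ∸ ∣ P ∣) C 2                          ≡⟨ sym (∣avoiding∣ P) ⟩
      length (avoiding P)                       ≡⟨ length-filter-split (λ L → avoids? L P) avoidsQ? allLabels ⟩
      length (filter avoidsP∧Q? allLabels) + X  ≤⟨ +-monoˡ-≤ X avoidsP∧Q⇒avoidsP∪Q ⟩
      length (avoiding (P ∪ Q)) + X             ≤⟨ +-monoˡ-≤ X (∣avoiding∣≤ (P ∪ Q) ∣P∣+4≤∣P∪Q∣) ⟩
      rest + X                                  ≡⟨ +-comm rest X ⟩
      X + rest                                  ∎)
      where
      open ≤-Reasoning
      rest = (10 ∸ (∣ P ∣ + 4)) C 2
      X = length (filter avoidsP∧meetsQ? allLabels)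
      avoidsP∧Q? = λ L → avoids? L P ×-dec avoids? L Q
      avoidsP∧Q⇒avoidsP∪Q : length (filter avoidsP∧Q? allLabels) ≤ length (avoiding (P ∪ Q))
      avoidsP∧Q⇒avoidsP∪Q =
        length-filter-mono avoidsP∧Q? (λ L → avoids? L (P ∪ Q)) (λ {L} → uncurry (Avoids-∪ {A = L})) allLabels
      ∣P∣+4≤∣P∪Q∣ : ∣ P ∣ + 4 ≤ ∣ P ∪ Q ∣
      ∣P∣+4≤∣P∪Q∣ = ≤-trans (+-monoʳ-≤ ∣ P ∣ 4≤∣Q∣) (≤-reflexive (sym (∣p∪q∣≡∣p∣+∣q∣ P Q P∩Q≡∅)))

    fewer₁-meetingQ : Empty (P ∩ₛ Q) → 4 ≤ ∣ Q ∣ →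
                      length (filter avoidsP∧meetsQ? (Nw ++ Fv)) < length (filter avoidsP∧meetsQ? allLabels)
    fewer₁-meetingQ P∩Q≡∅ 4≤∣Q∣ =
      ≤-trans (s≤s (∣filter∣≤6 avoidsP∧meetsQ? Nw Fv ∣Nw∣≤2 ∣Fv∣≤4)) (7≤∣avoidsP∧meetsQ∣ P∩Q≡∅ 4≤∣Q∣)

    firstLabel-meetingQ : Empty (P ∩ₛ Q) → 4 ≤ ∣ Q ∣ →
                          ∃[ L₁ ] Fits L₁ Nv (Nw ++ Fv) × ¬ Avoids L₁ Q
    firstLabel-meetingQ P∩Q≡∅ 4≤∣Q∣ =
      let L₁ , (L₁∉P , L₁∩Q) , L₁∉bad = pickLabel avoidsP∧meetsQ? (Nw ++ Fv) (fewer₁-meetingQ P∩Q≡∅ 4≤∣Q∣)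
      in  L₁ , Avoids⇒Fits L₁ L₁∉P L₁∉bad , L₁∩Q

    withSecondLabel : (L₁ : Label 10) → Fits L₁ Nv (Nw ++ Fv) → RoomForSecond L₁ →
                      ∃₂ λ L₁ L₂ → Disjoint L₁ L₂ × Fits L₁ Nv (Nw ++ Fv) × Fits L₂ Nw (Nv ++ Fw)
    withSecondLabel L₁ fits₁ fewer =
      let L₂ , L₂∩L₁ , fits₂ = secondLabel L₁ fewer
      in  L₁ , L₂ , Disjoint-sym {A = L₂} {B = L₁} L₂∩L₁ , fits₁ , fits₂

  twoLabels : ∃₂ λ L₁ L₂ → Disjoint L₁ L₂ × Fits L₁ Nv (Nw ++ Fv) × Fits L₂ Nw (Nv ++ Fw)
  twoLabels with ∣ Q ∣ ≤? 3 | length (filter avoidsQ? Nv) ≤? 1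
  ... | yes ∣Q∣≤3 | _ =
        let L₁ , fits₁ = firstLabel
        in  withSecondLabel L₁ fits₁ (room-small L₁ (≤-trans (∣S₂∣≤∣Q∣+2 L₁) (+-monoˡ-≤ 2 ∣Q∣≤3)))
  ... | no _ | yes few =
        let L₁ , fits₁ = firstLabel
        in  withSecondLabel L₁ fits₁ (room-few L₁ few)
  ... | no ∣Q∣≰3 | no many =
        let L₁ , fits₁ , L₁∩Q = firstLabel-meetingQ P∩Q≡∅ (≰⇒> ∣Q∣≰3)
        in  withSecondLabel L₁ fits₁
              (room-small L₁ (≤-trans (¬Avoids⇒∣S∪colours∣≤1+∣S∣ {A = L₁} L₁∩Q) (s≤s ∣Q∣≤4)))
    where
    allAvoidQ : All (λ B → Avoids B Q) Nv
    allAvoidQ = subst (All _) (filter-complete avoidsQ? ∣filter∣≡∣Nv∣) (all-filter avoidsQ? Nv)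
      where ∣filter∣≡∣Nv∣ = ≤-antisym (length-filter avoidsQ? Nv) (≤-trans ∣Nv∣≤2 (≰⇒> many))
    P∩Q≡∅ : Empty (P ∩ₛ Q)
    P∩Q≡∅ (c , c∈P∩Q) =
      let c∈P , c∈Q = x∈p∩q⁻ P Q c∈P∩Q
          B , B∈Nv , c∈B = ∈coloursOf⁻ Nv c∈P
      in  Avoids⇒∉ {A = B} (All.lookup allAvoidQ B∈Nv) c∈B c∈Q

-- Edges and short walks in the line graph

module _ {G : Graph} where

  private
    Vertex = Fin (n G)
    variable
      u x y z : Vertex
      e e′ m : Edge G

  short-walk-impossible : ∀ {ℓ} → e ≢ e′ → (LAdj e e′ → ℓ ≡ 0) → (∀ {m} → LAdj e m → LAdj m e′ → ℓ ≤ 1) →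
                          ℓ ≤ 2 → ¬ DistLe e e′ ℓ
  short-walk-impossible e≢e′ _     _   _                here                             = e≢e′ refl
  short-walk-impossible _    adj⇒0 _   _                (step e~e′ here) with () ← adj⇒0 e~e′
  short-walk-impossible _    _     ⇒≤1 _                (step e~m (step m~e′ here)) with s≤s () ← ⇒≤1 e~m m~e′
  short-walk-impossible _    _     _   (s≤s (s≤s ()))   (step _ (step _ (step _ _)))

  ¬DistLe-∣∩∣ : e ≢ e′ → (LAdj e e′ → Disjoint A B) → (∀ {m} → LAdj e m → LAdj m e′ → A ≢ B) →
               ¬ DistLe e e′ ∣ A ∩ B ∣
  ¬DistLe-∣∩∣ {A = A} {B = B} e≢e′ disjoint distinct =
    short-walk-impossible e≢e′ (Disjoint⇒∣A∩B∣≡0 {A = A} {B = B} ∘ disjoint)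
      (λ e~m m~e′ → A≢B⇒∣A∩B∣≤1 (distinct e~m m~e′)) (∣A∩B∣≤2 A B)

  Edge-≡ : ends₁ e ≡ ends₁ e′ → ends₂ e ≡ ends₂ e′ → e ≡ e′
  Edge-≡ {edge a b a<b ab} {edge .a .b a<b′ ab′} refl refl =
    cong₂ (edge a b) (<-irrelevant a<b a<b′) (Decidable⇒UIP.≡-irrelevant Bool._≟_ ab ab′)

  ends-of : x <ᶠ y → x ∈ₑ e → y ∈ₑ e → x ≡ ends₁ e × y ≡ ends₂ e
  ends-of x<y (inj₁ x≡₁) (inj₂ y≡₂) = x≡₁ , y≡₂
  ends-of x<y (inj₁ refl) (inj₁ refl) = contradiction refl (<⇒≢ x<y)
  ends-of x<y (inj₂ refl) (inj₂ refl) = contradiction refl (<⇒≢ x<y)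
  ends-of {e = e} x<y (inj₂ refl) (inj₁ refl) = contradiction (ordered e) (<-asym x<y)

  edge-unique : x ≢ y → x ∈ₑ e → y ∈ₑ e → x ∈ₑ e′ → y ∈ₑ e′ → e ≡ e′
  edge-unique {x = x} {y = y} {e = e} {e′ = e′} x≢y x∈e y∈e x∈e′ y∈e′ with <-cmp x y
  ... | tri< x<y _ _ = let x₁ , y₂ = ends-of {e = e} x<y x∈e y∈e
                           x₁′ , y₂′ = ends-of {e = e′} x<y x∈e′ y∈e′
                       in  Edge-≡ (trans (sym x₁) x₁′) (trans (sym y₂) y₂′)
  ... | tri≈ _ x≡y _ = contradiction x≡y x≢y
  ... | tri> _ _ y<x = let y₁ , x₂ = ends-of {e = e} y<x y∈e x∈e
                           y₁′ , x₂′ = ends-of {e = e′} y<x y∈e′ x∈e′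
                       in  Edge-≡ (trans (sym y₁) y₁′) (trans (sym x₂) x₂′)

  ∈ₑ⇒adj : x ≢ y → x ∈ₑ e → y ∈ₑ e → adj G x y ≡ true
  ∈ₑ⇒adj {x = x} {y = y} {e = e} x≢y x∈e y∈e with <-cmp x y
  ... | tri< x<y _ _ = let x₁ , y₂ = ends-of {e = e} x<y x∈e y∈e in
                       subst₂ (λ a b → adj G a b ≡ true) (sym x₁) (sym y₂) (isEdge e)
  ... | tri≈ _ x≡y _ = contradiction x≡y x≢y
  ... | tri> _ _ y<x = let y₁ , x₂ = ends-of {e = e} y<x y∈e x∈e in
                       trans (adj-sym G x y) (subst₂ (λ a b → adj G a b ≡ true) (sym y₁) (sym x₂) (isEdge e))

  adj⇒≢ : adj G x y ≡ true → x ≢ y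
  adj⇒≢ {x = x} xy refl = contradiction (trans (sym xy) (irrefl G x)) λ ()

  edgeBetween : adj G x y ≡ true → Edge G
  edgeBetween {x = x} {y = y} xy with <-cmp x y
  ... | tri< x<y _ _ = edge x y x<y xy
  ... | tri≈ _ x≡y _ = contradiction x≡y (adj⇒≢ xy)
  ... | tri> _ _ y<x = edge y x y<x (trans (adj-sym G y x) xy)

  ∈-edgeBetween : (xy : adj G x y ≡ true) → x ∈ₑ edgeBetween xy × y ∈ₑ edgeBetween xy
  ∈-edgeBetween {x = x} {y = y} xy with <-cmp x y
  ... | tri< _ _ _ = inj₁ refl , inj₂ refl
  ... | tri≈ _ x≡y _ = contradiction x≡y (adj⇒≢ xy)
  ... | tri> _ _ _ = inj₂ refl , inj₁ refl

  otherEnd : (e : Edge G) → x ∈ₑ e → Vertex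
  otherEnd e (inj₁ _) = ends₂ e
  otherEnd e (inj₂ _) = ends₁ e

  otherEnd-∈ₑ : (x∈e : x ∈ₑ e) → otherEnd e x∈e ∈ₑ e
  otherEnd-∈ₑ (inj₁ _) = inj₂ refl
  otherEnd-∈ₑ (inj₂ _) = inj₁ refl

  otherEnd-≢ : (x∈e : x ∈ₑ e) → x ≢ otherEnd e x∈e
  otherEnd-≢ {e = e} (inj₁ refl) = <⇒≢ (ordered e)
  otherEnd-≢ {e = e} (inj₂ refl) = <⇒≢ (ordered e) ∘ sym

  ∈ₑ-two : x ≢ y → x ∈ₑ e → y ∈ₑ e → z ∈ₑ e → z ≡ x ⊎ z ≡ y
  ∈ₑ-two x≢y (inj₁ refl) _           (inj₁ refl) = inj₁ refl
  ∈ₑ-two x≢y (inj₂ refl) _           (inj₂ refl) = inj₁ refl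
  ∈ₑ-two x≢y (inj₁ refl) (inj₁ refl) (inj₂ refl) = contradiction refl x≢y
  ∈ₑ-two x≢y (inj₁ refl) (inj₂ refl) (inj₂ refl) = inj₂ refl
  ∈ₑ-two x≢y (inj₂ refl) (inj₁ refl) (inj₁ refl) = inj₂ refl
  ∈ₑ-two x≢y (inj₂ refl) (inj₂ refl) (inj₁ refl) = contradiction refl x≢y

  LAdj-sym : LAdj e e′ → LAdj e′ e
  LAdj-sym (e≢e′ , s , s∈e , s∈e′) = e≢e′ ∘ sym , s , s∈e′ , s∈e

  disjoint⇒¬DistLe : e ≢ e′ → Disjoint A B → ¬ DistLe e e′ ∣ A ∩ B ∣
  disjoint⇒¬DistLe {A = A} {B = B} e≢e′ A∩B =
    ¬DistLe-∣∩∣ e≢e′ (λ _ → A∩B) (λ _ _ → Disjoint⇒≢ {A = A} {B = B} A∩B)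

  _≟ₑ_ : (e e′ : Edge G) → Dec (e ≡ e′)
  e ≟ₑ e′ with ends₁ e ≟ ends₁ e′ | ends₂ e ≟ ends₂ e′
  ... | yes p | yes q = yes (Edge-≡ p q)
  ... | no p  | _     = no (p ∘ cong ends₁)
  ... | _     | no q  = no (q ∘ cong ends₂)

  _∈ₑ?_ : (x : Vertex) (e : Edge G) → Dec (x ∈ₑ e)
  x ∈ₑ? e = (x ≟ ends₁ e) ⊎-dec (x ≟ ends₂ e)

  shared-end : u ≢ x → u ∈ₑ e → x ∈ₑ e → ¬ u ∈ₑ e′ → LAdj e e′ → x ∈ₑ e′
  shared-end {e = e} u≢x u∈e x∈e u∉e′ (_ , s , s∈e , s∈e′) with ∈ₑ-two {e = e} u≢x u∈e x∈e s∈e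
  ... | inj₁ refl = contradiction s∈e′ u∉e′
  ... | inj₂ refl = s∈e′

  neighbours : Vertex → List Vertex
  neighbours x = filter (λ y → adj G x y Bool.≟ true) (allFin (n G))

  deg≡∣neighbours∣ : (x : Vertex) → deg G x ≡ length (neighbours x)
  deg≡∣neighbours∣ x = sum-indicator≡length-filter (adj G x) (allFin (n G))

  ∈-neighbours⁺ : adj G x y ≡ true → y ∈ neighbours x
  ∈-neighbours⁺ {x = x} {y = y} = ∈-filter⁺ (λ y → adj G x y Bool.≟ true) (∈-allFin y)

  ∈-neighbours⁻ : y ∈ neighbours x → adj G x y ≡ true
  ∈-neighbours⁻ {x = x} = proj₂ ∘ ∈-filter⁻ (λ y → adj G x y Bool.≟ true) {xs = allFin (n G)}

  neighboursExcept : Vertex → Vertex → List Vertex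
  neighboursExcept x u = filter (λ y → ¬? (y ≟ u)) (neighbours x)

  ∈-neighboursExcept⁺ : adj G x y ≡ true → y ≢ u → y ∈ neighboursExcept x u
  ∈-neighboursExcept⁺ {u = u} xy = ∈-filter⁺ (λ y → ¬? (y ≟ u)) (∈-neighbours⁺ xy)

  ∈-neighboursExcept⁻ : y ∈ neighboursExcept x u → adj G x y ≡ true
  ∈-neighboursExcept⁻ {x = x} {u = u} =
    ∈-neighbours⁻ ∘ proj₁ ∘ ∈-filter⁻ (λ y → ¬? (y ≟ u)) {xs = neighbours x}

  ∣neighboursExcept∣<deg : adj G x u ≡ true → length (neighboursExcept x u) < deg G x
  ∣neighboursExcept∣<deg {x = x} {u = u} xu = begin-strict
    length (neighboursExcept x u)  <⟨ filter-notAll (λ y → ¬? (y ≟ u)) (neighbours x) u∈N ⟩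
    length (neighbours x)          ≡⟨ sym (deg≡∣neighbours∣ x) ⟩
    deg G x                        ∎
    where
    open ≤-Reasoning
    u∈N = Any.map (λ { refl u≢u → u≢u refl }) (∈-neighbours⁺ xu)

  ∣neighboursExcept∣≤2 : Subcubic G → adj G x u ≡ true → length (neighboursExcept x u) ≤ 2
  ∣neighboursExcept∣≤2 {x = x} subcubic xu = ≤-pred (≤-trans (∣neighboursExcept∣<deg xu) (subcubic x))

  degree-two : deg G u ≡ 2 →
               ∃₂ λ v w → v ≢ w × adj G u v ≡ true × adj G u w ≡ true × (∀ t → adj G u t ≡ true → t ≡ v ⊎ t ≡ w)
  degree-two {u} deg≡2 =
    two (neighbours u) (trans (sym (deg≡∣neighbours∣ u)) deg≡2) (Unique.filter⁺ _ (Unique.allFin⁺ (n G)))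
        ∈-neighbours⁻ ∈-neighbours⁺
    where
    two : (vs : List Vertex) → length vs ≡ 2 → Unique vs →
          (∀ {t} → t ∈ vs → adj G u t ≡ true) → (∀ {t} → adj G u t ≡ true → t ∈ vs) →
          ∃₂ λ v w → v ≢ w × adj G u v ≡ true × adj G u w ≡ true × (∀ t → adj G u t ≡ true → t ≡ v ⊎ t ≡ w)
    two (v ∷ w ∷ []) refl ((v≢w ∷ []) ∷ _) vs⊆N N⊆vs =
      v , w , v≢w , vs⊆N (here refl) , vs⊆N (there (here refl)) , λ t ut → v-or-w (N⊆vs ut)
      where
      v-or-w : ∀ {t} → t ∈ v ∷ w ∷ [] → t ≡ v ⊎ t ≡ w
      v-or-w (here t≡v)         = inj₁ t≡v
      v-or-w (there (here t≡w)) = inj₂ t≡w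

  _[_≔_] : PartialLabelling G k → Edge G → Label k → PartialLabelling G k
  (f [ e ≔ L ]) e′ = if does (e′ ≟ₑ e) then just L else f e′

  update-≡ : (f : PartialLabelling G k) (e : Edge G) (L : Label k) → (f [ e ≔ L ]) e ≡ just L
  update-≡ f e L rewrite dec-true (e ≟ₑ e) refl = refl

  update-≢ : (f : PartialLabelling G k) {e e′ : Edge G} (L : Label k) → e′ ≢ e → (f [ e ≔ L ]) e′ ≡ f e′
  update-≢ f {e} {e′} L e′≢e rewrite dec-false (e′ ≟ₑ e) e′≢e = refl

  module _ (f : PartialLabelling G k) where

    labelBetween : Vertex → Vertex → Maybe (Label k)
    labelBetween x y with adj G x y Bool.≟ true
    ... | yes xy = f (edgeBetween xy)
    ... | no _   = nothing

    labelBetween-≡ : x ≢ y → x ∈ₑ e → y ∈ₑ e → labelBetween x y ≡ f e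
    labelBetween-≡ {x = x} {y = y} {e = e} x≢y x∈e y∈e with adj G x y Bool.≟ true
    ... | yes xy = let x∈e′ , y∈e′ = ∈-edgeBetween xy in cong f (edge-unique x≢y x∈e′ y∈e′ x∈e y∈e)
    ... | no ¬xy = contradiction (∈ₑ⇒adj {e = e} x≢y x∈e y∈e) ¬xy

    nearLabels : Vertex → Vertex → List (Label k)
    nearLabels x u = mapMaybe (labelBetween x) (neighboursExcept x u)

    farLabels : Vertex → Vertex → List (Label k)
    farLabels x u = concatMap (λ y → nearLabels y x) (neighboursExcept x u)

    ∣nearLabels∣≤2 : Subcubic G → adj G x u ≡ true → length (nearLabels x u) ≤ 2
    ∣nearLabels∣≤2 {x = x} {u = u} subcubic xu =
      ≤-trans (length-mapMaybe (labelBetween x) (neighboursExcept x u)) (∣neighboursExcept∣≤2 subcubic xu)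

    ∣farLabels∣≤4 : Subcubic G → adj G x u ≡ true → length (farLabels x u) ≤ 4
    ∣farLabels∣≤4 {x = x} {u = u} subcubic xu =
      ≤-trans (length-concatMap≤ (λ y → nearLabels y x) (neighboursExcept x u)
                 (λ y∈N → ∣nearLabels∣≤2 subcubic (trans (adj-sym G _ x) (∈-neighboursExcept⁻ y∈N))))
              (*-mono-≤ (∣neighboursExcept∣≤2 subcubic xu) (≤-refl {2}))

    ∈-nearLabels : x ∈ₑ e → ¬ u ∈ₑ e → f e ≡ just B → B ∈ nearLabels x u
    ∈-nearLabels {x = x} {e = e} {u = u} x∈e u∉e fe =
      ∈-mapMaybe⁺ (neighboursExcept x u) y∈N (trans (labelBetween-≡ {e = e} x≢y x∈e y∈e) fe)
      where
      y∈e = otherEnd-∈ₑ {e = e} x∈e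
      x≢y = otherEnd-≢ {e = e} x∈e
      y∈N = ∈-neighboursExcept⁺ (∈ₑ⇒adj {e = e} x≢y x∈e y∈e) (λ y≡u → u∉e (subst (_∈ₑ e) y≡u y∈e))

    ∈-farLabels : y ∈ neighboursExcept x u → y ∈ₑ e → ¬ x ∈ₑ e → f e ≡ just B → B ∈ farLabels x u
    ∈-farLabels {e = e} y∈N y∈e x∉e fe =
      ∈-concatMap⁺ _ (Any.map (λ { refl → ∈-nearLabels {e = e} y∈e x∉e fe }) y∈N)

    module _ {u x y : Vertex} {e : Edge G} (u≢x : u ≢ x) (u∈e : u ∈ₑ e) (x∈e : x ∈ₑ e)
             (neighbours-u : ∀ t → adj G u t ≡ true → t ≡ x ⊎ t ≡ y)
             {e′ : Edge G} {B : Label k} (u∉e′ : ¬ u ∈ₑ e′) (fe′ : f e′ ≡ just B) where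

      label-at-distance-one : LAdj e e′ → B ∈ nearLabels x u
      label-at-distance-one e~e′ =
        ∈-nearLabels {e = e′} (shared-end {e = e} u≢x u∈e x∈e u∉e′ e~e′) u∉e′ fe′

      -- The middle edge m meets e either at u, so that m is the edge uy, or at x, so that m is an
      -- edge xr with r ≠ u; in the latter case e′ lies at x or at r.
      label-at-distance-two : LAdj e m → LAdj m e′ →
                              B ∈ nearLabels x u ⊎ B ∈ nearLabels y u ⊎ B ∈ farLabels x u
      label-at-distance-two {m = m} (e≢m , s , s∈e , s∈m) m~e′ with ∈ₑ-two {e = e} u≢x u∈e x∈e s∈e
      ... | inj₁ refl with neighbours-u t (∈ₑ⇒adj {e = m} s≢t s∈m t∈m)
        where
        t = otherEnd m s∈m
        t∈m = otherEnd-∈ₑ {e = m} s∈m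
        s≢t = otherEnd-≢ {e = m} s∈m
      ...   | inj₁ refl = contradiction (edge-unique {e = e} u≢x u∈e x∈e s∈m (otherEnd-∈ₑ {e = m} s∈m)) e≢m
      ...   | inj₂ t≡y  =
        inj₂ (inj₁ (∈-nearLabels {e = e′} (shared-end {e = m} u≢y s∈m y∈m u∉e′ m~e′) u∉e′ fe′))
        where
        y∈m = subst (_∈ₑ m) t≡y (otherEnd-∈ₑ {e = m} s∈m)
        u≢y = subst (u ≢_) t≡y (otherEnd-≢ {e = m} s∈m)
      label-at-distance-two {m = m} (e≢m , s , s∈e , s∈m) (m≢e′ , r , r∈m , r∈e′) | inj₂ refl
        with ∈ₑ-two {e = m} (otherEnd-≢ {e = m} s∈m) s∈m (otherEnd-∈ₑ {e = m} s∈m) r∈m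
      ... | inj₁ refl = inj₁ (∈-nearLabels {e = e′} r∈e′ u∉e′ fe′)
      ... | inj₂ refl = inj₂ (inj₂ (∈-farLabels {e = e′} r∈N r∈e′ x∉e′ fe′))
        where
        x≢r = otherEnd-≢ {e = m} s∈m
        x∉e′ : ¬ x ∈ₑ e′
        x∉e′ x∈e′ = m≢e′ (edge-unique {e = m} x≢r s∈m r∈m x∈e′ r∈e′)
        r≢u : r ≢ u
        r≢u refl = e≢m (edge-unique {e = e} u≢x u∈e x∈e r∈m s∈m)
        r∈N = ∈-neighboursExcept⁺ (∈ₑ⇒adj {e = m} x≢r s∈m r∈m) r≢u

      Fits⇒¬DistLe : {L : Label k} → Fits L (nearLabels x u) (nearLabels y u ++ farLabels x u) →
                     ¬ DistLe e e′ ∣ L ∩ B ∣ × ¬ DistLe e′ e ∣ B ∩ L ∣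
      Fits⇒¬DistLe {L} (near , L∉far) =
        ¬DistLe-∣∩∣ e≢e′ disjoint distinct ,
        ¬DistLe-∣∩∣ (e≢e′ ∘ sym) (Disjoint-sym {A = L} {B = B} ∘ disjoint ∘ LAdj-sym)
                    (λ e′~m m~e → distinct (LAdj-sym m~e) (LAdj-sym e′~m) ∘ sym)
        where
        e≢e′ : e ≢ e′
        e≢e′ refl = u∉e′ u∈e
        disjoint : LAdj e e′ → Disjoint L B
        disjoint = near ∘ label-at-distance-one
        distinct : LAdj e m → LAdj m e′ → L ≢ B
        distinct e~m m~e′ with label-at-distance-two e~m m~e′
        ... | inj₁ B∈near         = Disjoint⇒≢ {A = L} (near B∈near)
        ... | inj₂ (inj₁ B∈nearʸ) = λ { refl → L∉far (∈-++⁺ˡ B∈nearʸ) }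
        ... | inj₂ (inj₂ B∈far)   = λ { refl → L∉far (∈-++⁺ʳ _ B∈far) }

  -- The extension

  module Extension {f : PartialLabelling G 10} (f-2tone : Is2Tone f)
                   {u v w : Vertex} (v≢w : v ≢ w) (uv : adj G u v ≡ true) (uw : adj G u w ≡ true)
                   (neighbours-u : ∀ t → adj G u t ≡ true → t ≡ v ⊎ t ≡ w)
                   {Lv Lw : Label 10} (Lv∩Lw : Disjoint Lv Lw)
                   (fits-v : Fits Lv (nearLabels f v u) (nearLabels f w u ++ farLabels f v u))
                   (fits-w : Fits Lw (nearLabels f w u) (nearLabels f v u ++ farLabels f w u)) where

    ev ew : Edge G
    ev = edgeBetween uv
    ew = edgeBetween uw

    u∈ev : u ∈ₑ ev
    u∈ev = proj₁ (∈-edgeBetween uv)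

    v∈ev : v ∈ₑ ev
    v∈ev = proj₂ (∈-edgeBetween uv)

    u∈ew : u ∈ₑ ew
    u∈ew = proj₁ (∈-edgeBetween uw)

    w∈ew : w ∈ₑ ew
    w∈ew = proj₂ (∈-edgeBetween uw)

    u≢v : u ≢ v
    u≢v = adj⇒≢ uv

    u≢w : u ≢ w
    u≢w = adj⇒≢ uw

    ev≢ew : ev ≢ ew
    ev≢ew ev≡ew with ∈ₑ-two {e = ew} u≢w u∈ew w∈ew (subst (v ∈ₑ_) ev≡ew v∈ev)
    ... | inj₁ v≡u = u≢v (sym v≡u)
    ... | inj₂ v≡w = v≢w v≡w

    edge-kind : (e : Edge G) → e ≡ ev ⊎ e ≡ ew ⊎ ¬ u ∈ₑ e
    edge-kind e with u ∈ₑ? e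
    ... | no u∉e  = inj₂ (inj₂ u∉e)
    ... | yes u∈e with neighbours-u t (∈ₑ⇒adj {e = e} (otherEnd-≢ {e = e} u∈e) u∈e t∈e)
      where
      t = otherEnd e u∈e
      t∈e = otherEnd-∈ₑ {e = e} u∈e
    ...   | inj₁ refl = inj₁ (edge-unique {e = e} u≢v u∈e (otherEnd-∈ₑ {e = e} u∈e) u∈ev v∈ev)
    ...   | inj₂ refl = inj₂ (inj₁ (edge-unique {e = e} u≢w u∈e (otherEnd-∈ₑ {e = e} u∈e) u∈ew w∈ew))

    g : PartialLabelling G 10
    g = (f [ ev ≔ Lv ]) [ ew ≔ Lw ]

    g-ev : g ev ≡ just Lv
    g-ev = trans (update-≢ (f [ ev ≔ Lv ]) Lw ev≢ew) (update-≡ f ev Lv)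

    g-ew : g ew ≡ just Lw
    g-ew = update-≡ (f [ ev ≔ Lv ]) ew Lw

    g-agrees : ∀ e → ¬ u ∈ₑ e → g e ≡ f e
    g-agrees e u∉e = trans (update-≢ (f [ ev ≔ Lv ]) Lw (λ { refl → u∉e u∈ew }))
                           (update-≢ f Lv (λ { refl → u∉e u∈ev }))

    g-defined : ∀ e → u ∈ₑ e → g e ≢ nothing
    g-defined e u∈e with edge-kind e
    ... | inj₁ refl        = λ gₑ → contradiction (trans (sym g-ev) gₑ) λ ()
    ... | inj₂ (inj₁ refl) = λ gₑ → contradiction (trans (sym g-ew) gₑ) λ ()
    ... | inj₂ (inj₂ u∉e)  = contradiction u∈e u∉e

    ev-vs-old : ∀ {e′ B} → ¬ u ∈ₑ e′ → g e′ ≡ just B → ¬ DistLe ev e′ ∣ Lv ∩ B ∣ × ¬ DistLe e′ ev ∣ B ∩ Lv ∣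
    ev-vs-old {e′} u∉e′ gₑ′ =
      Fits⇒¬DistLe f {e = ev} u≢v u∈ev v∈ev neighbours-u u∉e′ (trans (sym (g-agrees e′ u∉e′)) gₑ′) fits-v

    ew-vs-old : ∀ {e′ B} → ¬ u ∈ₑ e′ → g e′ ≡ just B → ¬ DistLe ew e′ ∣ Lw ∩ B ∣ × ¬ DistLe e′ ew ∣ B ∩ Lw ∣
    ew-vs-old {e′} u∉e′ gₑ′ =
      Fits⇒¬DistLe f {e = ew} u≢w u∈ew w∈ew (λ t → Sum.swap ∘ neighbours-u t) u∉e′
                   (trans (sym (g-agrees e′ u∉e′)) gₑ′) fits-w

    g-2tone : Is2Tone g
    g-2tone e e′ A B e≢e′ gₑ gₑ′ with edge-kind e | edge-kind e′
    ... | inj₁ refl        | inj₁ refl        = contradiction refl e≢e′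
    ... | inj₂ (inj₁ refl) | inj₂ (inj₁ refl) = contradiction refl e≢e′
    ... | inj₁ refl        | inj₂ (inj₁ refl) with refl ← trans (sym gₑ) g-ev | refl ← trans (sym gₑ′) g-ew =
      disjoint⇒¬DistLe {A = Lv} {B = Lw} e≢e′ Lv∩Lw
    ... | inj₂ (inj₁ refl) | inj₁ refl        with refl ← trans (sym gₑ) g-ew | refl ← trans (sym gₑ′) g-ev =
      disjoint⇒¬DistLe {A = Lw} {B = Lv} e≢e′ (Disjoint-sym {A = Lv} {B = Lw} Lv∩Lw)
    ... | inj₁ refl        | inj₂ (inj₂ u∉e′) with refl ← trans (sym gₑ) g-ev = proj₁ (ev-vs-old u∉e′ gₑ′)
    ... | inj₂ (inj₁ refl) | inj₂ (inj₂ u∉e′) with refl ← trans (sym gₑ) g-ew = proj₁ (ew-vs-old u∉e′ gₑ′)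
    ... | inj₂ (inj₂ u∉e)  | inj₁ refl        with refl ← trans (sym gₑ′) g-ev = proj₂ (ev-vs-old u∉e gₑ)
    ... | inj₂ (inj₂ u∉e)  | inj₂ (inj₁ refl) with refl ← trans (sym gₑ′) g-ew = proj₂ (ew-vs-old u∉e gₑ)
    ... | inj₂ (inj₂ u∉e)  | inj₂ (inj₂ u∉e′) =
      f-2tone e e′ A B e≢e′ (trans (sym (g-agrees e u∉e)) gₑ) (trans (sym (g-agrees e′ u∉e′)) gₑ′)

mainTheorem12 : (G : Graph) → Subcubic G →
    (f : PartialLabelling G 10) → Is2Tone f →
    (u : Fin (n G)) → deg G u ≡ 2 →
    (∀ (e : Edge G) → u ∈ₑ e → f e ≡ nothing) →
    ∃ λ (g : PartialLabelling G 10) → Is2Tone g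
    × (∀ (e : Edge G) → ¬ (u ∈ₑ e) → g e ≡ f e)
    × (∀ (e : Edge G) → u ∈ₑ e → g e ≢ nothing)
mainTheorem12 G subcubic f f-2tone u deg≡2 _ =
  -- The new labels overwrite f on both edges at u, so it is irrelevant that they were uncoloured.
  let v , w , v≢w , uv , uw , neighbours-u = degree-two {G = G} {u = u} deg≡2
      vu = trans (adj-sym G v u) uv
      wu = trans (adj-sym G w u) uw
      Lv , Lw , Lv∩Lw , fits-v , fits-w =
        twoLabels (nearLabels f v u) (nearLabels f w u) (farLabels f v u) (farLabels f w u)
                  (∣nearLabels∣≤2 f subcubic vu) (∣nearLabels∣≤2 f subcubic wu)
                  (∣farLabels∣≤4 f subcubic vu) (∣farLabels∣≤4 f subcubic wu)
      open Extension {G = G} {f = f} f-2tone v≢w uv uw neighbours-u Lv∩Lw fits-v fits-w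
  in  g , g-2tone , g-agrees , g-defined
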